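{- There is a translation $\mathscr{T}_{\mathsf{c}}$ of formulas and proofs that assigns, to every proof $p$ of a sequent $\Delta \vdash \Gamma$ in LK$^-$, a proof $\mathscr{T}_{\mathsf{c}}(p)$ of the sequent $! \mathscr{T}_{\mathsf{c}}^\ast(\Delta) \vdash ? \mathscr{T}_{\mathsf{c}}^\ast(\Gamma)$ in LLK$^-$, where $\mathscr{T}_{\mathsf{c}}(\top) = \top$, $\mathscr{T}_{\mathsf{c}}(\bot) = \bot$, $\mathscr{T}_{\mathsf{c}}(A \wedge B) = ? \mathscr{T}_{\mathsf{c}}(A) \,\&\, ? \mathscr{T}_{\mathsf{c}}(B)$, $\mathscr{T}_{\mathsf{c}}(A \vee B) = ! \mathscr{T}_{\mathsf{c}}(A) \oplus ! \mathscr{T}_{\mathsf{c}}(B)$ and $\mathscr{T}_{\mathsf{c}}(A \Rightarrow B) = ! ? \mathscr{T}_{\mathsf{c}}(A) \multimap ? ! \mathscr{T}_{\mathsf{c}}(B)$.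
   Context: Propositional logic. Notation: $!$ is the exponential "of course", $?$ is "why not", $⅋$ is par; for $f \in \{!, ?\}$, $f(A_1, \dots, A_k) = fA_1, \dots, fA_k$, and $\mathscr{T}_{\mathsf{c}}^\ast$ applies $\mathscr{T}_{\mathsf{c}}$ to each formula of a sequence. LK$^-$ is the sequent calculus for classical logic with constants $\top,\bot$ and connectives $\wedge,\vee,\Rightarrow$ (negation defined by $\neg A = A \Rightarrow \bot$) with rules: Id ($A \vdash A$); Cut (from $\Delta \vdash B, \Gamma$ and $\Delta', B \vdash \Gamma'$ infer $\Delta, \Delta' \vdash \Gamma, \Gamma'$); exchange XL, XR; weakening WL, WR; contraction CL, CR; $\top$L (from $\Delta \vdash \Gamma$ infer $\Delta, \top \vdash \Gamma$); $\top$R ($\vdash \top$); $\bot$L ($\bot \vdash$); $\bot$R (from $\Delta \vdash \Gamma$ infer $\Delta \vdash \bot, \Gamma$); $\wedge$L (from $\Delta, A_1, A_2 \vdash \Gamma$ infer $\Delta, A_1 \wedge A_2 \vdash \Gamma$); $\wedge$R (from $\Delta \vdash B_1, \Gamma$ and $\Delta \vdash B_2, \Gamma$ infer $\Delta \vdash B_1 \wedge B_2, \Gamma$); $\vee$L (from $\Delta, A_1 \vdash \Gamma$ and $\Delta, A_2 \vdash \Gamma$ infer $\Delta, A_1 \vee A_2 \vdash \Gamma$); $\vee$R (from $\Delta \vdash B_1, B_2, \Gamma$ infer $\Delta \vdash B_1 \vee B_2, \Gamma$); $\Rightarrow$L (from $\Delta \vdash A, \Gamma$ and $\Delta, B \vdash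 \Gamma$ infer $\Delta, A \Rightarrow B \vdash \Gamma$); $\Rightarrow$R$^-$ (from $A \vdash B, \Gamma$ infer $\vdash A \Rightarrow B, \Gamma$). LLK$^-$ is the two-sided sequent calculus for LL$^-$ (propositional linear logic with $\top, \bot, 1, 0, \otimes, ⅋, \&, \oplus, \multimap, !, ?$ but without linear negation; here $\top$ is the unit of $\otimes$ and $\bot$ that of $⅋$) with rules: Id; Cut$^-$ (from $\Delta \vdash B$ and $\Delta', B \vdash \Gamma'$ infer $\Delta, \Delta' \vdash \Gamma'$); XL, XR; $!$W, $?$W (weakening on $!A$ on the left, $?B$ on the right); $!$C, $?$C (contraction); $!$D (from $\Delta, A \vdash \Gamma$ infer $\Delta, !A \vdash \Gamma$), $?$D (from $\Delta \vdash B, \Gamma$ infer $\Delta \vdash ?B, \Gamma$); $?$L (from $!\Delta, A \vdash ?\Gamma$ infer $!\Delta, ?A \vdash ?\Gamma$); $!$R (from $!\Delta \vdash B, ?\Gamma$ infer $!\Delta \vdash !B, ?\Gamma$); $0$L ($0 \vdash \Gamma$); $1$R ($\Delta \vdash 1, \Gamma$); $\top$L, $\top$R ($\vdash \top$), $\bot$L ($\bot \vdash$), $\bot$R; $\otimes$L (from $\Delta, A_1, A_2 \vdash \Gamma$ infer $\Delta, A_1 \otimes A_2 \vdash \Gamma$); $\otimes$R$^-$ (from $\Delta_1 \vdash B_1$ and $\Delta_2 \vdash B_2$ infer $\Delta_1, \Delta_2 \vdash B_1 \otimes B_2$); $\&$L (from $\Delta, A_i \vdash \Gamma$ infer $\Delta,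 A_1 \& A_2 \vdash \Gamma$); $\&$R$^-$ (from $\Delta \vdash B_1$ and $\Delta \vdash B_2$ infer $\Delta \vdash B_1 \& B_2$); $⅋$L$^-$ (from $A_1 \vdash \Gamma_1$ and $A_2 \vdash \Gamma_2$ infer $A_1 ⅋ A_2 \vdash \Gamma_1, \Gamma_2$); $⅋$R (from $\Delta \vdash B_1, B_2, \Gamma$ infer $\Delta \vdash B_1 ⅋ B_2, \Gamma$); $\oplus$L$^-$ (from $A_1 \vdash \Gamma$ and $A_2 \vdash \Gamma$ infer $A_1 \oplus A_2 \vdash \Gamma$); $\oplus$R (from $\Delta \vdash B_i, \Gamma$ infer $\Delta \vdash B_1 \oplus B_2, \Gamma$); $\multimap$L (from $\Delta_1 \vdash A, \Gamma_1$ and $\Delta_2, B \vdash \Gamma_2$ infer $\Delta_1, \Delta_2, A \multimap B \vdash \Gamma_1, \Gamma_2$); $\multimap$R$^-$ (from $A \vdash B, \Gamma$ infer $\vdash A \multimap B, \Gamma$); and the distribution rules: from $\Delta, ?!A \vdash \Gamma$ infer $\Delta, !?A \vdash \Gamma$; from $\Delta \vdash !?B, \Gamma$ infer $\Delta \vdash ?!B, \Gamma$; from $\Delta, (A \otimes B) ⅋ C \vdash \Gamma$ infer $\Delta, A, B ⅋ C \vdash \Gamma$; from $\Delta \vdash A \otimes (B ⅋ C), \Gamma$ infer $\Delta \vdash A \otimes B, C, \Gamma$. -}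

module Defs where

open import Data.Nat using (ℕ)
open import Data.List using (List; []; _∷_; _++_; [_]; map)

data Fm : Set where
  atom : ℕ → Fm
  ⊤c ⊥c : Fm
  _∧c_ _∨c_ _⇒c_ : Fm → Fm → Fm

-- Formulas of LL⁻ (no linear negation); ⊤l is the unit of ⊗, ⊥l of ⅋

data LF : Set where
  atom : ℕ → LF
  ⊤l ⊥l 1l 0l : LF
  _⊗_ _⅋_ _&_ _⊕_ _⊸_ : LF → LF → LF
  !_ ⁇_ : LF → LF

infixr 7 _⊗_ _⅋_ _&_ _⊕_
infixr 6 _⊸_
infix 9 !_ ⁇_

-- Sequents: Δ ⊢ Γ with Δ, Γ lists.  "Δ, A" is  Δ ++ [ A ]  (left),
-- "B, Γ" is  B ∷ Γ  (right).

data LK : List Fm → List Fm → Set where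
  Id   : ∀ {A} → LK [ A ] [ A ]
  Cut  : ∀ {Δ Δ' Γ Γ' B} → LK Δ (B ∷ Γ) → LK (Δ' ++ [ B ]) Γ' → LK (Δ ++ Δ') (Γ ++ Γ')
  XL   : ∀ {Δ Δ' Γ A B} → LK (Δ ++ A ∷ B ∷ Δ') Γ → LK (Δ ++ B ∷ A ∷ Δ') Γ
  XR   : ∀ {Δ Γ Γ' A B} → LK Δ (Γ ++ A ∷ B ∷ Γ') → LK Δ (Γ ++ B ∷ A ∷ Γ')
  WL   : ∀ {Δ Γ A} → LK Δ Γ → LK (Δ ++ [ A ]) Γ
  WR   : ∀ {Δ Γ B} → LK Δ Γ → LK Δ (B ∷ Γ)
  CL   : ∀ {Δ Γ A} → LK (Δ ++ A ∷ A ∷ []) Γ → LK (Δ ++ [ A ]) Γ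
  CR   : ∀ {Δ Γ B} → LK Δ (B ∷ B ∷ Γ) → LK Δ (B ∷ Γ)
  ⊤L   : ∀ {Δ Γ} → LK Δ Γ → LK (Δ ++ [ ⊤c ]) Γ
  ⊤R   : LK [] [ ⊤c ]
  ⊥L   : LK [ ⊥c ] []
  ⊥R   : ∀ {Δ Γ} → LK Δ Γ → LK Δ (⊥c ∷ Γ)
  ∧L   : ∀ {Δ Γ A₁ A₂} → LK (Δ ++ A₁ ∷ A₂ ∷ []) Γ → LK (Δ ++ [ A₁ ∧c A₂ ]) Γ
  ∧R   : ∀ {Δ Γ B₁ B₂} → LK Δ (B₁ ∷ Γ) → LK Δ (B₂ ∷ Γ) → LK Δ (B₁ ∧c B₂ ∷ Γ)
  ∨L   : ∀ {Δ Γ A₁ A₂} → LK (Δ ++ [ A₁ ]) Γ → LK (Δ ++ [ A₂ ]) Γ → LK (Δ ++ [ A₁ ∨c A₂ ]) Γ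
  ∨R   : ∀ {Δ Γ B₁ B₂} → LK Δ (B₁ ∷ B₂ ∷ Γ) → LK Δ (B₁ ∨c B₂ ∷ Γ)
  ⇒L   : ∀ {Δ Γ A B} → LK Δ (A ∷ Γ) → LK (Δ ++ [ B ]) Γ → LK (Δ ++ [ A ⇒c B ]) Γ
  ⇒R⁻  : ∀ {Γ A B} → LK [ A ] (B ∷ Γ) → LK [] (A ⇒c B ∷ Γ)

data LLK : List LF → List LF → Set where
  Id   : ∀ {A} → LLK [ A ] [ A ]
  Cut⁻ : ∀ {Δ Δ' Γ' B} → LLK Δ [ B ] → LLK (Δ' ++ [ B ]) Γ' → LLK (Δ ++ Δ') Γ'
  XL   : ∀ {Δ Δ' Γ A B} → LLK (Δ ++ A ∷ B ∷ Δ') Γ → LLK (Δ ++ B ∷ A ∷ Δ') Γ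
  XR   : ∀ {Δ Γ Γ' A B} → LLK Δ (Γ ++ A ∷ B ∷ Γ') → LLK Δ (Γ ++ B ∷ A ∷ Γ')
  !W   : ∀ {Δ Γ A} → LLK Δ Γ → LLK (Δ ++ [ ! A ]) Γ
  ⁇W   : ∀ {Δ Γ B} → LLK Δ Γ → LLK Δ (⁇ B ∷ Γ)
  !C   : ∀ {Δ Γ A} → LLK (Δ ++ ! A ∷ ! A ∷ []) Γ → LLK (Δ ++ [ ! A ]) Γ
  ⁇C   : ∀ {Δ Γ B} → LLK Δ (⁇ B ∷ ⁇ B ∷ Γ) → LLK Δ (⁇ B ∷ Γ)
  !D   : ∀ {Δ Γ A} → LLK (Δ ++ [ A ]) Γ → LLK (Δ ++ [ ! A ]) Γ
  ⁇D   : ∀ {Δ Γ B} → LLK Δ (B ∷ Γ) → LLK Δ (⁇ B ∷ Γ)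
  ⁇L   : ∀ {Δ Γ A} → LLK (map !_ Δ ++ [ A ]) (map ⁇_ Γ) → LLK (map !_ Δ ++ [ ⁇ A ]) (map ⁇_ Γ)
  !R   : ∀ {Δ Γ B} → LLK (map !_ Δ) (B ∷ map ⁇_ Γ) → LLK (map !_ Δ) (! B ∷ map ⁇_ Γ)
  0L   : ∀ {Γ} → LLK [ 0l ] Γ
  1R   : ∀ {Δ Γ} → LLK Δ (1l ∷ Γ)
  ⊤L   : ∀ {Δ Γ} → LLK Δ Γ → LLK (Δ ++ [ ⊤l ]) Γ
  ⊤R   : LLK [] [ ⊤l ]
  ⊥L   : LLK [ ⊥l ] []
  ⊥R   : ∀ {Δ Γ} → LLK Δ Γ → LLK Δ (⊥l ∷ Γ)
  ⊗L   : ∀ {Δ Γ A₁ A₂} → LLK (Δ ++ A₁ ∷ A₂ ∷ []) Γ → LLK (Δ ++ [ A₁ ⊗ A₂ ]) Γ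
  ⊗R⁻  : ∀ {Δ₁ Δ₂ B₁ B₂} → LLK Δ₁ [ B₁ ] → LLK Δ₂ [ B₂ ] → LLK (Δ₁ ++ Δ₂) [ B₁ ⊗ B₂ ]
  &L₁  : ∀ {Δ Γ A₁ A₂} → LLK (Δ ++ [ A₁ ]) Γ → LLK (Δ ++ [ A₁ & A₂ ]) Γ
  &L₂  : ∀ {Δ Γ A₁ A₂} → LLK (Δ ++ [ A₂ ]) Γ → LLK (Δ ++ [ A₁ & A₂ ]) Γ
  &R⁻  : ∀ {Δ B₁ B₂} → LLK Δ [ B₁ ] → LLK Δ [ B₂ ] → LLK Δ [ B₁ & B₂ ]
  ⅋L⁻  : ∀ {Γ₁ Γ₂ A₁ A₂} → LLK [ A₁ ] Γ₁ → LLK [ A₂ ] Γ₂ → LLK [ A₁ ⅋ A₂ ] (Γ₁ ++ Γ₂)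
  ⅋R   : ∀ {Δ Γ B₁ B₂} → LLK Δ (B₁ ∷ B₂ ∷ Γ) → LLK Δ (B₁ ⅋ B₂ ∷ Γ)
  ⊕L⁻  : ∀ {Γ A₁ A₂} → LLK [ A₁ ] Γ → LLK [ A₂ ] Γ → LLK [ A₁ ⊕ A₂ ] Γ
  ⊕R₁  : ∀ {Δ Γ B₁ B₂} → LLK Δ (B₁ ∷ Γ) → LLK Δ (B₁ ⊕ B₂ ∷ Γ)
  ⊕R₂  : ∀ {Δ Γ B₁ B₂} → LLK Δ (B₂ ∷ Γ) → LLK Δ (B₁ ⊕ B₂ ∷ Γ)
  ⊸L   : ∀ {Δ₁ Δ₂ Γ₁ Γ₂ A B} → LLK Δ₁ (A ∷ Γ₁) → LLK (Δ₂ ++ [ B ]) Γ₂ →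
         LLK (Δ₁ ++ Δ₂ ++ [ A ⊸ B ]) (Γ₁ ++ Γ₂)
  ⊸R⁻  : ∀ {Γ A B} → LLK [ A ] (B ∷ Γ) → LLK [] (A ⊸ B ∷ Γ)
  !⁇L  : ∀ {Δ Γ A} → LLK (Δ ++ [ ⁇ ! A ]) Γ → LLK (Δ ++ [ ! ⁇ A ]) Γ
  ⁇!R  : ∀ {Δ Γ B} → LLK Δ (! ⁇ B ∷ Γ) → LLK Δ (⁇ ! B ∷ Γ)
  distL : ∀ {Δ Γ A B C} → LLK (Δ ++ [ (A ⊗ B) ⅋ C ]) Γ → LLK (Δ ++ A ∷ (B ⅋ C) ∷ []) Γ
  distR : ∀ {Δ Γ A B C} → LLK Δ (A ⊗ (B ⅋ C) ∷ Γ) → LLK Δ ((A ⊗ B) ∷ C ∷ Γ)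

Tc : Fm → LF
Tc (atom x) = atom x
Tc ⊤c = ⊤l
Tc ⊥c = ⊥l
Tc (A ∧c B) = ⁇ Tc A & ⁇ Tc B
Tc (A ∨c B) = ! Tc A ⊕ ! Tc B
Tc (A ⇒c B) = ! ⁇ Tc A ⊸ ⁇ ! Tc B

!Tc* : List Fm → List LF
!Tc* Δ = map (λ A → ! Tc A) Δ

⁇Tc* : List Fm → List LF
⁇Tc* Γ = map (λ A → ⁇ Tc A) Γ

-- Because every formula
-- of a translated sequent is under ! on the left and ⁇ on the right, promotion
-- (!R, ⁇L), dereliction, weakening and contraction are always available, so the
-- structural rules of LK⁻ translate directly and context-splitting rules such as
-- ⊸L can be made context-sharing by contracting afterwards.  The remaining
-- difficulty is that Cut⁻, &R⁻ and ⊕L⁻ require empty side contexts on one side.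
-- A general cut is recovered by packing contexts with ⊗ and ⅋ and using the
-- distribution rule; with it, side contexts can be moved to the other side of the
-- sequent as negations B ⊸ ⊥ and back again.
module Submission where

open import Defs
open import Data.List using (List; []; _∷_; _++_; [_]; map; foldr)
open import Data.List.Properties using (map-++; ++-assoc; ++-identityʳ; map-∘)
open import Data.List.Relation.Binary.Permutation.Propositional
  using (_↭_; refl; prep; swap; trans; ↭-sym)
open import Data.List.Relation.Binary.Permutation.Propositional.Properties
  using (shift; ∷↭∷ʳ; ++-comm; ++⁺ˡ)
open import Relation.Binary.PropositionalEquality
  using (_≡_; sym; cong; subst; subst₂)
  renaming (trans to ≡-trans)

private
  variable
    A B C : LF
    Δ Δ' Γ Γ' : List LF

castˡ : Δ ≡ Δ' → LLK Δ Γ → LLK Δ' Γ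
castˡ {Γ = Γ} = subst (λ Δ → LLK Δ Γ)

castʳ : Γ ≡ Γ' → LLK Δ Γ → LLK Δ Γ'
castʳ {Δ = Δ} = subst (LLK Δ)

!* ⁇* : List LF → List LF
!* = map !_
⁇* = map ⁇_

exchange-afterˡ : ∀ Δ₀ → Δ ↭ Δ' → LLK (Δ₀ ++ Δ) Γ → LLK (Δ₀ ++ Δ') Γ
exchange-afterˡ Δ₀ refl p = p
exchange-afterˡ Δ₀ (prep {xs} {ys} x π) p =
  castˡ (++-assoc Δ₀ [ x ] ys)
    (exchange-afterˡ (Δ₀ ++ [ x ]) π (castˡ (sym (++-assoc Δ₀ [ x ] xs)) p))
exchange-afterˡ Δ₀ (swap {xs} {ys} x y π) p =
  castˡ (++-assoc Δ₀ (y ∷ x ∷ []) ys)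
    (exchange-afterˡ (Δ₀ ++ y ∷ x ∷ []) π
      (castˡ (sym (++-assoc Δ₀ (y ∷ x ∷ []) xs)) (XL {Δ = Δ₀} p)))
exchange-afterˡ Δ₀ (trans π ρ) p = exchange-afterˡ Δ₀ ρ (exchange-afterˡ Δ₀ π p)

exchange-afterʳ : ∀ Γ₀ → Γ ↭ Γ' → LLK Δ (Γ₀ ++ Γ) → LLK Δ (Γ₀ ++ Γ')
exchange-afterʳ Γ₀ refl p = p
exchange-afterʳ Γ₀ (prep {xs} {ys} x π) p =
  castʳ (++-assoc Γ₀ [ x ] ys)
    (exchange-afterʳ (Γ₀ ++ [ x ]) π (castʳ (sym (++-assoc Γ₀ [ x ] xs)) p))
exchange-afterʳ Γ₀ (swap {xs} {ys} x y π) p =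
  castʳ (++-assoc Γ₀ (y ∷ x ∷ []) ys)
    (exchange-afterʳ (Γ₀ ++ y ∷ x ∷ []) π
      (castʳ (sym (++-assoc Γ₀ (y ∷ x ∷ []) xs)) (XR {Γ = Γ₀} p)))
exchange-afterʳ Γ₀ (trans π ρ) p = exchange-afterʳ Γ₀ ρ (exchange-afterʳ Γ₀ π p)

exchangeˡ : Δ ↭ Δ' → LLK Δ Γ → LLK Δ' Γ
exchangeˡ = exchange-afterˡ []

exchangeʳ : Γ ↭ Γ' → LLK Δ Γ → LLK Δ Γ'
exchangeʳ = exchange-afterʳ []

⨂ ⅋⋆ : List LF → LF
⨂ = foldr _⊗_ ⊤l
⅋⋆ = foldr _⅋_ ⊥l

⊗R⁻⋆ : ∀ Δ → LLK Δ [ ⨂ Δ ]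
⊗R⁻⋆ [] = ⊤R
⊗R⁻⋆ (A ∷ Δ) = ⊗R⁻ {Δ₁ = [ A ]} Id (⊗R⁻⋆ Δ)

⊗L⋆ : ∀ Δ₀ Δ → LLK (Δ₀ ++ Δ) Γ → LLK (Δ₀ ++ [ ⨂ Δ ]) Γ
⊗L⋆ Δ₀ [] p = ⊤L (castˡ (++-identityʳ Δ₀) p)
⊗L⋆ Δ₀ (A ∷ Δ) p =
  ⊗L {Δ = Δ₀} (castˡ (++-assoc Δ₀ [ A ] [ ⨂ Δ ])
    (⊗L⋆ (Δ₀ ++ [ A ]) Δ (castˡ (sym (++-assoc Δ₀ [ A ] Δ)) p)))

⅋L⁻⋆ : ∀ Γ → LLK [ ⅋⋆ Γ ] Γ
⅋L⁻⋆ [] = ⊥L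
⅋L⁻⋆ (B ∷ Γ) = ⅋L⁻ {Γ₁ = [ B ]} Id (⅋L⁻⋆ Γ)

⅋R⋆ : ∀ Γ → LLK Δ (Γ ++ Γ') → LLK Δ (⅋⋆ Γ ∷ Γ')
⅋R⋆ [] p = ⊥R p
⅋R⋆ {Γ' = Γ'} (B ∷ Γ) p =
  ⅋R (XR {Γ = []} (⅋R⋆ Γ (exchangeʳ (↭-sym (shift B Γ Γ')) p)))

-- Pack Γ into ⅋⋆ Γ next
-- to C and Δ' into ⨂ Δ'; by distL a proof of (⨂ Δ' ⊗ C) ⅋ ⅋⋆ Γ ⊢ Γ' ++ Γ, which
-- ⅋L⁻ builds from q and ⅋L⁻⋆ Γ, proves ⨂ Δ', C ⅋ ⅋⋆ Γ ⊢ Γ' ++ Γ.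
cut : LLK Δ (C ∷ Γ) → LLK (Δ' ++ [ C ]) Γ' → LLK (Δ ++ Δ') (Γ ++ Γ')
cut {Δ = Δ} {C = C} {Γ = Γ} {Δ' = Δ'} {Γ' = Γ'} p q =
  exchangeˡ (++-comm Δ' Δ) (exchangeʳ (++-comm Γ' Γ)
    (Cut⁻ {Δ = Δ'} (⊗R⁻⋆ Δ') (Cut⁻ {Δ' = [ ⨂ Δ' ]} C⅋Γ ⨂Δ',C⅋Γ)))
  where
  C⅋Γ : LLK Δ [ C ⅋ ⅋⋆ Γ ]
  C⅋Γ = ⅋R (XR {Γ = []} (⅋R⋆ Γ (exchangeʳ (∷↭∷ʳ C Γ) p)))
  ⨂Δ'⊗C : LLK [ ⨂ Δ' ⊗ C ] Γ'
  ⨂Δ'⊗C = ⊗L {Δ = []} (XL {Δ = []} (⊗L⋆ [ C ] Δ' (exchangeˡ (↭-sym (∷↭∷ʳ C Δ')) q)))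
  ⨂Δ',C⅋Γ : LLK (⨂ Δ' ∷ C ⅋ ⅋⋆ Γ ∷ []) (Γ' ++ Γ)
  ⨂Δ',C⅋Γ = distL {Δ = []} (⅋L⁻ ⨂Δ'⊗C (⅋L⁻⋆ Γ))

precompose : LLK [ A ] [ B ] → LLK (Δ ++ [ B ]) Γ → LLK (Δ ++ [ A ]) Γ
precompose {A = A} {Δ = Δ} h p = exchangeˡ (∷↭∷ʳ A Δ) (Cut⁻ {Δ = [ A ]} h p)

postcompose : LLK [ A ] [ B ] → LLK Δ (A ∷ Γ) → LLK Δ (B ∷ Γ)
postcompose {B = B} {Δ} {Γ} h p =
  castˡ (++-identityʳ Δ) (exchangeʳ (↭-sym (∷↭∷ʳ B Γ)) (cut {Δ' = []} p h))

neg : LF → LF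
neg B = B ⊸ ⊥l

neg-unit : LLK [] (neg B ∷ B ∷ [])
neg-unit = ⊸R⁻ (⊥R Id)

neg-counit : LLK (B ∷ neg B ∷ []) []
neg-counit {B = B} = ⊸L {Δ₁ = [ B ]} {Δ₂ = []} {Γ₁ = []} {Γ₂ = []} Id ⊥L

negˡ : LLK Δ (B ∷ Γ) → LLK (Δ ++ [ neg B ]) Γ
negˡ {Γ = Γ} p = castʳ (++-identityʳ Γ) (cut p (XL {Δ = []} neg-counit))

negˡ⁻¹ : LLK (Δ ++ [ neg B ]) Γ → LLK Δ (B ∷ Γ)
negˡ⁻¹ = cut {Δ = []} neg-unit

negʳ : LLK (Δ ++ [ A ]) Γ → LLK Δ (neg A ∷ Γ)
negʳ = cut {Δ = []} (XR {Γ = []} neg-unit)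

negʳ⁻¹ : LLK Δ (neg A ∷ Γ) → LLK (Δ ++ [ A ]) Γ
negʳ⁻¹ {Γ = Γ} p = castʳ (++-identityʳ Γ) (cut p neg-counit)

negˡ⋆ : ∀ Γ₁ → LLK Δ (Γ₁ ++ Γ) → LLK (Δ ++ map neg Γ₁) Γ
negˡ⋆ [] p = castˡ (sym (++-identityʳ _)) p
negˡ⋆ {Δ = Δ} (B ∷ Γ₁) p = castˡ (++-assoc Δ [ neg B ] (map neg Γ₁)) (negˡ⋆ Γ₁ (negˡ p))

negˡ⋆⁻¹ : ∀ Γ₁ → LLK (Δ ++ map neg Γ₁) Γ → LLK Δ (Γ₁ ++ Γ)
negˡ⋆⁻¹ [] p = castˡ (++-identityʳ _) p
negˡ⋆⁻¹ {Δ = Δ} (B ∷ Γ₁) p =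
  negˡ⁻¹ (negˡ⋆⁻¹ Γ₁ (castˡ (sym (++-assoc Δ [ neg B ] (map neg Γ₁))) p))

negʳ⋆ : ∀ Δ₁ → LLK (Δ ++ Δ₁) Γ → LLK Δ (map neg Δ₁ ++ Γ)
negʳ⋆ [] p = castˡ (++-identityʳ _) p
negʳ⋆ {Δ = Δ} (A ∷ Δ₁) p = negʳ (negʳ⋆ Δ₁ (castˡ (sym (++-assoc Δ [ A ] Δ₁)) p))

negʳ⋆⁻¹ : ∀ Δ₁ → LLK Δ (map neg Δ₁ ++ Γ) → LLK (Δ ++ Δ₁) Γ
negʳ⋆⁻¹ [] p = castˡ (sym (++-identityʳ _)) p
negʳ⋆⁻¹ {Δ = Δ} (A ∷ Δ₁) p = castˡ (++-assoc Δ [ A ] Δ₁) (negʳ⋆⁻¹ Δ₁ (negʳ⁻¹ p))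

&R : LLK Δ (A ∷ Γ) → LLK Δ (B ∷ Γ) → LLK Δ (A & B ∷ Γ)
&R {Δ = Δ} {A = A} {Γ = Γ} {B = B} p q =
  exchangeʳ (↭-sym (∷↭∷ʳ (A & B) Γ)) (negˡ⋆⁻¹ Γ (&R⁻ (isolate p) (isolate q)))
  where
  isolate : ∀ {C} → LLK Δ (C ∷ Γ) → LLK (Δ ++ map neg Γ) [ C ]
  isolate {C} r = negˡ⋆ Γ (exchangeʳ (∷↭∷ʳ C Γ) r)

⊕L : LLK (Δ ++ [ A ]) Γ → LLK (Δ ++ [ B ]) Γ → LLK (Δ ++ [ A ⊕ B ]) Γ
⊕L {Δ = Δ} {A = A} {Γ = Γ} {B = B} p q =
  exchangeˡ (∷↭∷ʳ (A ⊕ B) Δ) (negʳ⋆⁻¹ Δ (⊕L⁻ (isolate p) (isolate q)))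
  where
  isolate : ∀ {C} → LLK (Δ ++ [ C ]) Γ → LLK [ C ] (map neg Δ ++ Γ)
  isolate {C} r = negʳ⋆ Δ (exchangeˡ (↭-sym (∷↭∷ʳ C Δ)) r)

!C-head : LLK (! A ∷ ! A ∷ Δ) Γ → LLK (! A ∷ Δ) Γ
!C-head {A = A} {Δ = Δ} p =
  exchangeˡ (↭-sym (∷↭∷ʳ (! A) Δ)) (!C {Δ = Δ} (exchangeˡ (++-comm (! A ∷ ! A ∷ []) Δ) p))

!C⋆ : ∀ L → LLK (!* L ++ !* L ++ Δ) Γ → LLK (!* L ++ Δ) Γ
!C⋆ [] p = p
!C⋆ {Δ = Δ} (A ∷ L) p =
  exchangeˡ (shift (! A) (!* L) Δ)
    (!C⋆ L (exchangeˡ (trans (↭-sym (shift (! A) (!* L) (!* L ++ Δ)))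
                             (++⁺ˡ (!* L) (↭-sym (shift (! A) (!* L) Δ))))
      (!C-head (exchangeˡ (prep (! A) (shift (! A) (!* L) (!* L ++ Δ))) p))))

⁇C⋆ : ∀ R → LLK Δ (⁇* R ++ ⁇* R ++ Γ) → LLK Δ (⁇* R ++ Γ)
⁇C⋆ [] p = p
⁇C⋆ {Γ = Γ} (B ∷ R) p =
  exchangeʳ (shift (⁇ B) (⁇* R) Γ)
    (⁇C⋆ R (exchangeʳ (trans (↭-sym (shift (⁇ B) (⁇* R) (⁇* R ++ Γ)))
                             (++⁺ˡ (⁇* R) (↭-sym (shift (⁇ B) (⁇* R) Γ))))
      (⁇C (exchangeʳ (prep (⁇ B) (shift (⁇ B) (⁇* R) (⁇* R ++ Γ))) p))))

⊸L-shared : ∀ L R → LLK (!* L) (A ∷ ⁇* R) → LLK (!* L ++ [ B ]) (⁇* R) →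
            LLK (!* L ++ [ A ⊸ B ]) (⁇* R)
⊸L-shared L R p q =
  castʳ (++-identityʳ (⁇* R)) (⁇C⋆ R (castʳ (cong (⁇* R ++_) (sym (++-identityʳ (⁇* R))))
    (!C⋆ L (⊸L {Δ₁ = !* L} p q))))

!⁇L-at : ∀ L L' R → LLK (!* L ++ ! A ∷ !* L') (⁇* R) → LLK (!* L ++ ! ⁇ A ∷ !* L') (⁇* R)
!⁇L-at {A = A} L L' R p =
  exchangeˡ (↭-sym (toEnd (⁇ A)))
    (!⁇L {Δ = !* (L ++ L')} (⁇L {Δ = L ++ L'} {Γ = R} (exchangeˡ (toEnd A) p)))
  where
  toEnd : ∀ A → !* L ++ ! A ∷ !* L' ↭ !* (L ++ L') ++ [ ! A ]
  toEnd A = subst (λ Ξ → !* L ++ ! A ∷ !* L' ↭ Ξ ++ [ ! A ]) (sym (map-++ !_ L L'))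
              (trans (shift (! A) (!* L) (!* L')) (∷↭∷ʳ (! A) (!* L ++ !* L')))

⁇!R-head : ∀ L R → LLK (!* L) (⁇ A ∷ ⁇* R) → LLK (!* L) (⁇ ! A ∷ ⁇* R)
⁇!R-head L R p = ⁇!R (!R {Δ = L} {Γ = R} p)

!⁇&L : ∀ L R → LLK (!* L ++ ! A ∷ ! B ∷ []) (⁇* R) → LLK (!* L ++ [ ! (⁇ A & ⁇ B) ]) (⁇* R)
!⁇&L {A = A} {B = B} L R p =
  precompose split
    (⊗L {Δ = !* L} (!⁇L-at L [ ⁇ A ] R (XL {Δ = !* L} (!⁇L-at L [ B ] R p))))
  where
  split : LLK [ ! (⁇ A & ⁇ B) ] [ ! ⁇ B ⊗ ! ⁇ A ]
  split = !C {Δ = []} (⊗R⁻ (!R {Δ = [ _ ]} {Γ = []} (!D {Δ = []} (&L₂ {Δ = []} Id)))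
                          (!R {Δ = [ _ ]} {Γ = []} (!D {Δ = []} (&L₁ {Δ = []} Id))))

⁇!⊕R : ∀ L R → LLK (!* L) (⁇ A ∷ ⁇ B ∷ ⁇* R) → LLK (!* L) (⁇ (! A ⊕ ! B) ∷ ⁇* R)
⁇!⊕R {B = B} L R p =
  ⁇C (postcompose (⁇L {Δ = []} {Γ = [ _ ]} (⁇D (⊕R₂ Id))) (⁇!R-head L (_ ∷ R)
    (XR {Γ = []} (postcompose (⁇L {Δ = []} {Γ = [ _ ]} (⁇D (⊕R₁ Id))) (⁇!R-head L (B ∷ R) p)))))

Tc* : List Fm → List LF
Tc* = map Tc

!*Tc*-++ : ∀ Δ Δ' → !* (Tc* (Δ ++ Δ')) ≡ !* (Tc* Δ) ++ !* (Tc* Δ')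
!*Tc*-++ Δ Δ' = ≡-trans (cong !* (map-++ Tc Δ Δ')) (map-++ !_ (Tc* Δ) (Tc* Δ'))

⁇*Tc*-++ : ∀ Γ Γ' → ⁇* (Tc* (Γ ++ Γ')) ≡ ⁇* (Tc* Γ) ++ ⁇* (Tc* Γ')
⁇*Tc*-++ Γ Γ' = ≡-trans (cong ⁇* (map-++ Tc Γ Γ')) (map-++ ⁇_ (Tc* Γ) (Tc* Γ'))

translate : ∀ {Δ Γ : List Fm} → LK Δ Γ → LLK (!* (Tc* Δ)) (⁇* (Tc* Γ))
translate Id = !D {Δ = []} (⁇D Id)
translate (Cut {Δ} {Δ'} {Γ} {Γ'} {B} p q) rewrite !*Tc*-++ Δ Δ' | ⁇*Tc*-++ Γ Γ' =
  cut (!R {Δ = Tc* Δ} {Γ = Tc* Γ} (translate p))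
      (!⁇L-at (Tc* Δ') [] (Tc* Γ') (castˡ (!*Tc*-++ Δ' [ B ]) (translate q)))
translate (XL {Δ} {Δ'} {A = A} {B} p) rewrite !*Tc*-++ Δ (B ∷ A ∷ Δ') =
  XL {Δ = !* (Tc* Δ)} (castˡ (!*Tc*-++ Δ (A ∷ B ∷ Δ')) (translate p))
translate (XR {Γ = Γ} {Γ'} {A} {B} p) rewrite ⁇*Tc*-++ Γ (B ∷ A ∷ Γ') =
  XR {Γ = ⁇* (Tc* Γ)} (castʳ (⁇*Tc*-++ Γ (A ∷ B ∷ Γ')) (translate p))
translate (WL {Δ} {A = A} p) rewrite !*Tc*-++ Δ [ A ] = !W (translate p)
translate (WR p) = ⁇W (translate p)
translate (CL {Δ} {A = A} p) rewrite !*Tc*-++ Δ [ A ] =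
  !C (castˡ (!*Tc*-++ Δ (A ∷ A ∷ [])) (translate p))
translate (CR p) = ⁇C (translate p)
translate (⊤L {Δ} p) rewrite !*Tc*-++ Δ [ ⊤c ] = !W (translate p)
translate ⊤R = ⁇D ⊤R
translate ⊥L = !D {Δ = []} ⊥L
translate (⊥R p) = ⁇D (⊥R (translate p))
translate (∧L {Δ} {Γ} {A₁} {A₂} p) rewrite !*Tc*-++ Δ [ A₁ ∧c A₂ ] =
  !⁇&L (Tc* Δ) (Tc* Γ) (castˡ (!*Tc*-++ Δ (A₁ ∷ A₂ ∷ [])) (translate p))
translate (∧R p q) = ⁇D (&R (translate p) (translate q))
translate (∨L {Δ} {A₁ = A₁} {A₂} p q) rewrite !*Tc*-++ Δ [ A₁ ∨c A₂ ] =
  !D {Δ = !* (Tc* Δ)}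
    (⊕L (castˡ (!*Tc*-++ Δ [ A₁ ]) (translate p)) (castˡ (!*Tc*-++ Δ [ A₂ ]) (translate q)))
translate (∨R {Δ} {Γ} p) = ⁇!⊕R (Tc* Δ) (Tc* Γ) (translate p)
translate (⇒L {Δ} {Γ} {A} {B} p q) rewrite !*Tc*-++ Δ [ A ⇒c B ] =
  !D {Δ = !* (Tc* Δ)} (⊸L-shared (Tc* Δ) (Tc* Γ)
    (!R {Δ = Tc* Δ} {Γ = Tc* Γ} (translate p))
    (⁇L {Δ = Tc* Δ} {Γ = Tc* Γ} (castˡ (!*Tc*-++ Δ [ B ]) (translate q))))
translate (⇒R⁻ {Γ} {A} {B} p) =
  ⁇D (⊸R⁻ (!⁇L-at [] [] (! Tc B ∷ Tc* Γ) (⁇!R-head [ Tc A ] (Tc* Γ) (translate p))))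

mainTheorem1 : {Δ Γ : List Fm} → LK Δ Γ → LLK (!Tc* Δ) (⁇Tc* Γ)
mainTheorem1 {Δ} {Γ} p = subst₂ LLK (sym (map-∘ Δ)) (sym (map-∘ Γ)) (translate p)
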